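{- Let $k\ge0$ be an integer, $t\in[[0,2^k-1]]$, and $r_1,r_2\in[[0,2^k-1]]$ with $r_1\le r_2$. The following algorithm terminates and returns $\mathrm{nsi}_k(t,r_1,r_2)$; it uses only a constant number of $k$-bit variables and executes $O(k)$ elementary operations (arithmetic, comparison, bit-wise and bit-reversal operations) on $k$-bit integers. 1. $t''\leftarrow(t+1)\bmod 2^k$; 2. $l\leftarrow0$; 3. repeat: (a) $t'\leftarrow t''$; (b) while $l<k$ and $t'\bmod 2^{l+1}=0$ do $l\leftarrow l+1$; (c) $x_1\leftarrow\mathrm{rev}_k(t')$; (d) $t''\leftarrow(t'+2^l)\bmod 2^k$; (e) $x_2\leftarrow\mathrm{rev}_k(t'+2^l-1)$; 4. until $r_1\le x_2$ and $r_2\ge x_1$ and $\lceil (r_1-x_1)/2^{k-l}\rceil\le\lfloor (r_2-x_1)/2^{k-l}\rfloor$; 5. $c\leftarrow 2^{k-1}$; 6. while $x_1<r_1$ or $x_1>r_2$ do: (a) if $x_1<r_1$ then $x_1\leftarrow x_1+c$ else $x_1\leftarrow x_1-c$; (b) $c\leftarrow c/2$; 7. return $\mathrm{rev}_k(x_1)$.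
   Context: $[[a,b]]=\{x\in\mathbb{Z}: a\le x\le b\}$. For $x=\sum_{i=0}^{k-1}x_i2^i\in[[0,2^k-1]]$ ($x_i\in\{0,1\}$), $\mathrm{rev}_k(x)=\sum_{i=0}^{k-1}x_i2^{k-1-i}$. For $r_1\le r_2$ in $[[0,2^k-1]]$ and $t\in[[0,2^k-1]]$, $\mathrm{nsi}_k(t,r_1,r_2)=(t+\tau(t,r_1,r_2))\bmod 2^k$ where $\tau(t,r_1,r_2)=\min\{d>0 : \mathrm{rev}_k((t+d)\bmod 2^k)\in[[r_1,r_2]]\}$, i.e. the next time slot (mod $2^k$) after $t$ whose $k$-bit reversal lies in $[r_1,r_2]$. -}

module Defs where

open import Data.Bool using (Bool; true; false; if_then_else_; _∧_; _∨_)
open import Data.Maybe using (Maybe; just; nothing)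
open import Data.Nat using (ℕ; zero; suc; _+_; _*_; _∸_; _^_; _≤_; _<_; _<ᵇ_; _≡ᵇ_; _≤ᵇ_)
open import Data.Nat.DivMod using (_/_; _%_)
open import Data.Nat.Properties using (m^n≢0)
open import Data.Integer as ℤ using (ℤ; +_; -_; _/ℕ_)
open import Data.Product using (Σ; ∃; _×_; _,_)
open import Relation.Binary.PropositionalEquality using (_≡_)

-- rev_k x = Σ_{i<k} x_i 2^{k-1-i}, where x_i is the i-th binary digit of x
-- (written recursively: the lowest bit of x gets weight 2^{k-1}).
rev : ℕ → ℕ → ℕ
rev zero    x = 0
rev (suc k) x = (x % 2) * 2 ^ k + rev k (x / 2)

modPow2 : ℕ → ℕ → ℕ
modPow2 x e = _%_ x (2 ^ e) ⦃ m^n≢0 2 e ⦄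

IsNsi : ℕ → ℕ → ℕ → ℕ → ℕ → Set
IsNsi k t r₁ r₂ y =
  Σ ℕ λ d →
    (0 < d) ×
    (r₁ ≤ rev k (modPow2 (t + d) k) × rev k (modPow2 (t + d) k) ≤ r₂) ×
    ((d' : ℕ) → 0 < d' → d' < d →
       rev k (modPow2 (t + d') k) < r₁ ⊎′ r₂ < rev k (modPow2 (t + d') k)) ×
    (y ≡ modPow2 (t + d) k)
  where open import Data.Sum using () renaming (_⊎_ to _⊎′_)

-- The algorithm, as a small-step machine.  Every transition corresponds to
-- one iteration of one of the loops (3, 3(b), 6) or to a constant number of
-- elementary k-bit operations; the machine state consists of a constant
-- number of k-bit variables.  Any undefined operation (bit reversal of a
-- number outside [[0,2^k-1]], a negative x₁, a fractional c) leads to 'fail'.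

floorDiv : ℤ → ℕ → ℤ
floorDiv a e = _/ℕ_ a (2 ^ e) ⦃ m^n≢0 2 e ⦄

ceilDiv : ℤ → ℕ → ℤ
ceilDiv a e = - floorDiv (- a) e

-- c is represented by its exponent: just j means c = 2^j,
-- nothing means c = 2^{-1} (or smaller), i.e. c is not an integer.
CExp : Set
CExp = Maybe ℕ

initC : ℕ → CExp
initC zero    = nothing
initC (suc k) = just k

halveC : CExp → CExp
halveC nothing        = nothing
halveC (just zero)    = nothing
halveC (just (suc j)) = just j

data St : Set where
  repeatTop : (l t'' : ℕ) → St        -- at step 3(a)
  innerLoop : (l t' : ℕ) → St         -- at the test of the while loop 3(b)
  fixLoop   : (x₁ : ℕ) (c : CExp) → St -- at the test of the while loop 6
  done      : ℕ → St
  fail      : St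

revChk : ℕ → ℕ → Maybe ℕ
revChk k x = if x <ᵇ 2 ^ k then just (rev k x) else nothing

_≤ℤᵇ_ : ℤ → ℤ → Bool
_≤ℤᵇ_ = ℤ._≤ᵇ_

step : (k r₁ r₂ : ℕ) → St → St
step k r₁ r₂ (repeatTop l t'') = innerLoop l t''
step k r₁ r₂ (innerLoop l t') =
  if (l <ᵇ k) ∧ (modPow2 t' (suc l) ≡ᵇ 0)
  then innerLoop (suc l) t'
  else after (revChk k t') (revChk k (t' + 2 ^ l ∸ 1))
  where
  t'' : ℕ
  t'' = modPow2 (t' + 2 ^ l) k
  after : Maybe ℕ → Maybe ℕ → St
  after (just x₁) (just x₂) =
    if (r₁ ≤ᵇ x₂) ∧ (x₁ ≤ᵇ r₂)
         ∧ (ceilDiv (+ r₁ ℤ.- + x₁) (k ∸ l) ≤ℤᵇ floorDiv (+ r₂ ℤ.- + x₁) (k ∸ l))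
    then fixLoop x₁ (initC k)
    else repeatTop l t''
  after _ _ = fail
step k r₁ r₂ (fixLoop x₁ c) =
  if (x₁ <ᵇ r₁) ∨ (r₂ <ᵇ x₁) then body c else ret (revChk k x₁)
  where
  body : CExp → St
  body nothing  = fail
  body (just j) =
    if x₁ <ᵇ r₁ then fixLoop (x₁ + 2 ^ j) (halveC c)
    else (if 2 ^ j ≤ᵇ x₁ then fixLoop (x₁ ∸ 2 ^ j) (halveC c) else fail)
  ret : Maybe ℕ → St
  ret (just y) = done y
  ret nothing  = fail
step k r₁ r₂ (done y) = done y
step k r₁ r₂ fail     = fail

run : (k r₁ r₂ : ℕ) → ℕ → St → St
run k r₁ r₂ zero    s = s
run k r₁ r₂ (suc n) s = run k r₁ r₂ n (step k r₁ r₂ s)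

initSt : ℕ → ℕ → St
initSt k t = repeatTop 0 (modPow2 (t + 1) k)

module Submission where

-- The slots after t are scanned in aligned blocks [t′, t′ + 2^L) with 2^L ∣ t′: the inner loop makes L
-- maximal, and after a missed block the next start t′ + 2^L is divisible by 2^(L+1), so L grows with
-- every block and there are at most k of them.  Bit reversal maps the block onto the grid
-- x₁ + m 2^(k-L), m < 2^L, where x₁ = rev_k t′ and slot t′ + j carries the grid point m = rev_L j;
-- step 4 tests whether this grid meets [[r₁, r₂]] by comparing a ceiling with a floor.  The earliest
-- hitting slot belongs to the grid point in [[r₁, r₂]] whose index m is most divisible by 2: if 2^f ∣ m
-- then rev_L m < 2^(L-f), and every j below 2^(L-f) has 2^f ∣ rev_L j.  The binary search of step 6
-- finds that point: with c = 2^(e-1) it stays at some x₁ + w with 2^e ∣ w and keeps every target within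
-- distance 2^e of it, so the first target it meets is the only one divisible by 2^e.

open import Defs
open import Data.Bool using (Bool; true; false; T; _∧_)
import Data.Integer as ℤ
import Data.Integer.Properties as ℤ
open import Data.Maybe using (just)
open import Data.Nat
open import Data.Nat.Properties
open import Data.Nat.DivMod
open import Data.Nat.Divisibility
open import Data.Nat.Tactic.RingSolver using (solve-∀)
open import Data.Product using (Σ; ∃; _×_; _,_; proj₁; proj₂; map₂)
open import Data.Sum using (_⊎_; inj₁; inj₂)
open import Relation.Nullary using (¬_; yes; no; contradiction)
open import Relation.Nullary.Reflects using (Reflects; ofʸ; ofⁿ; fromEquivalence; _×-reflects_; T-reflects)
open import Relation.Binary.PropositionalEquality

module _ {A : Set} where

  Reflects-true : ∀ {b} → Reflects A b → A → b ≡ true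
  Reflects-true (ofʸ _)  _ = refl
  Reflects-true (ofⁿ ¬a) a = contradiction a ¬a

  Reflects-false : ∀ {b} → Reflects A b → ¬ A → b ≡ false
  Reflects-false (ofʸ a) ¬a = contradiction a ¬a
  Reflects-false (ofⁿ _) _  = refl

  Reflects-invertʸ : ∀ {b} → Reflects A b → b ≡ true → A
  Reflects-invertʸ (ofʸ a) refl = a

  Reflects-invertⁿ : ∀ {b} → Reflects A b → b ≡ false → ¬ A
  Reflects-invertⁿ (ofⁿ ¬a) refl = ¬a

≡ᵇ-reflects-≡ : ∀ m n → Reflects (m ≡ n) (m ≡ᵇ n)
≡ᵇ-reflects-≡ m n = fromEquivalence (≡ᵇ⇒≡ m n) (≡⇒≡ᵇ m n)

2^-split : ∀ {m n} → m ≤ n → 2 ^ n ≡ 2 ^ (n ∸ m) * 2 ^ m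
2^-split {m} {n} m≤n = trans (cong (2 ^_) (sym (m∸n+n≡m m≤n))) (^-distribˡ-+-* 2 (n ∸ m) m)

2^-mono-∣ : ∀ {m n} → m ≤ n → 2 ^ m ∣ 2 ^ n
2^-mono-∣ {m} {n} m≤n = divides (2 ^ (n ∸ m)) (2^-split m≤n)

multiples-close⇒≡ : ∀ {g a b} → g ∣ a → g ∣ b → a < b + g → b < a + g → a ≡ b
multiples-close⇒≡ {g} (divides p refl) (divides q refl) a<b+g b<a+g =
  cong (_* g) (≤-antisym (factor≤ p q a<b+g) (factor≤ q p b<a+g))
  where
  factor≤ : ∀ p q → p * g < q * g + g → p ≤ q
  factor≤ p q h = <⇒≤pred (*-cancelʳ-< g p (suc q) (subst (p * g <_) (+-comm (q * g) g) h))

2^∣*2^ : ∀ {e n} y → 2 ^ (e ∸ n) ∣ y → 2 ^ e ∣ y * 2 ^ n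
2^∣*2^ {e} {n} y 2^[e∸n]∣y = ∣-trans (2^-mono-∣ (subst (e ≤_) (+-comm n (e ∸ n)) (m≤n+m∸n e n)))
  (subst (_∣ y * 2 ^ n) (sym (^-distribˡ-+-* 2 (e ∸ n) n)) (*-monoˡ-∣ (2 ^ n) 2^[e∸n]∣y))

2^∣*2^⁻¹ : ∀ {e n} y → 2 ^ e ∣ y * 2 ^ n → 2 ^ (e ∸ n) ∣ y
2^∣*2^⁻¹ {e} {n} y 2^e∣y*2^n with n ≤? e
... | no  n≰e = subst (λ z → 2 ^ z ∣ y) (sym (m≤n⇒m∸n≡0 (<⇒≤ (≰⇒> n≰e)))) (1∣ y)
... | yes n≤e = *-cancelʳ-∣ (2 ^ n) ⦃ m^n≢0 2 n ⦄
  (subst (_∣ y * 2 ^ n) (2^-split n≤e) 2^e∣y*2^n)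

2^∣+2^ : ∀ L {t} → 2 ^ L ∣ t → ¬ (2 ^ suc L ∣ t) → 2 ^ suc L ∣ t + 2 ^ L
2^∣+2^ L (divides q refl) 2^1+L∤t = divides (suc (q / 2)) (begin
  q * 2 ^ L + 2 ^ L                 ≡⟨ cong (λ z → z * 2 ^ L + 2 ^ L) q≡1+[q/2]*2 ⟩
  (1 + q / 2 * 2) * 2 ^ L + 2 ^ L   ≡⟨ regroup (q / 2) (2 ^ L) ⟩
  suc (q / 2) * (2 * 2 ^ L)         ∎)
  where
  open ≡-Reasoning
  regroup : ∀ a p → (1 + a * 2) * p + p ≡ suc a * (2 * p)
  regroup = solve-∀
  q≡1+[q/2]*2 : q ≡ 1 + q / 2 * 2
  q≡1+[q/2]*2 with q % 2 in q%2≡ | m%n<n q 2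
  ... | 0 | _ = contradiction (divides (q / 2) q*2^L≡) 2^1+L∤t
    where
    q*2^L≡ : q * 2 ^ L ≡ q / 2 * 2 ^ suc L
    q*2^L≡ = trans (cong (_* 2 ^ L) (trans (m≡m%n+[m/n]*n q 2) (cong (_+ q / 2 * 2) q%2≡)))
                   (*-assoc (q / 2) 2 (2 ^ L))
  ... | 1 | _ = trans (m≡m%n+[m/n]*n q 2) (cong (_+ q / 2 * 2) q%2≡)
  ... | suc (suc _) | s≤s (s≤s ())

aligned-block-fits : ∀ {l k t} → l ≤ k → 2 ^ l ∣ t → t < 2 ^ k → t + 2 ^ l ≤ 2 ^ k
aligned-block-fits {l} {k} l≤k (divides q refl) q*2^l<2^k = begin
  q * 2 ^ l + 2 ^ l         ≡⟨ +-comm (q * 2 ^ l) (2 ^ l) ⟩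
  suc q * 2 ^ l             ≤⟨ *-monoˡ-≤ (2 ^ l) (*-cancelʳ-< (2 ^ l) q (2 ^ (k ∸ l))
                                 (subst (q * 2 ^ l <_) (2^-split l≤k) q*2^l<2^k)) ⟩
  2 ^ (k ∸ l) * 2 ^ l       ≡⟨ 2^-split l≤k ⟨
  2 ^ k                     ∎
  where open ≤-Reasoning

-- Bit reversal

rev<2^ : ∀ k x → rev k x < 2 ^ k
rev<2^ zero    x = s≤s z≤n
rev<2^ (suc k) x = begin-strict
  (x % 2) * 2 ^ k + rev k (x / 2) <⟨ +-monoʳ-< ((x % 2) * 2 ^ k) (rev<2^ k (x / 2)) ⟩
  (x % 2) * 2 ^ k + 2 ^ k         ≤⟨ +-monoˡ-≤ (2 ^ k) (*-monoˡ-≤ (2 ^ k) (≤-pred (m%n<n x 2))) ⟩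
  1 * 2 ^ k + 2 ^ k               ≡⟨ cong (_+ 2 ^ k) (*-identityˡ (2 ^ k)) ⟩
  2 ^ k + 2 ^ k                   ≡⟨ cong (2 ^ k +_) (+-identityʳ (2 ^ k)) ⟨
  2 * 2 ^ k                       ∎
  where open ≤-Reasoning

[m+2n]%2≡m%2 : ∀ m n → (m + 2 * n) % 2 ≡ m % 2
[m+2n]%2≡m%2 m n = trans (cong (λ z → (m + z) % 2) (*-comm 2 n)) ([m+kn]%n≡m%n m n 2)

[m+2n]/2≡m/2+n : ∀ m n → (m + 2 * n) / 2 ≡ m / 2 + n
[m+2n]/2≡m/2+n m n = begin
  (m + 2 * n) / 2       ≡⟨ +-distrib-/-∣ʳ m (divides n (*-comm 2 n)) ⟩
  m / 2 + (2 * n) / 2   ≡⟨ cong (λ z → m / 2 + z / 2) (*-comm 2 n) ⟩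
  m / 2 + (n * 2) / 2   ≡⟨ cong (m / 2 +_) (m*n/n≡m n 2) ⟩
  m / 2 + n             ∎
  where open ≡-Reasoning

rev-concat : ∀ j n a b → a < 2 ^ j → rev (j + n) (a + 2 ^ j * b) ≡ rev j a * 2 ^ n + rev n b
rev-concat zero    n zero    b _        = cong (rev n) (+-identityʳ b)
rev-concat zero    n (suc a) b (s≤s ())
rev-concat (suc j) n a       b a<2^1+j = begin
  ((a + 2 ^ suc j * b) % 2) * 2 ^ (j + n) + rev (j + n) ((a + 2 ^ suc j * b) / 2)
    ≡⟨ cong₂ (λ u v → u * 2 ^ (j + n) + rev (j + n) v)
         (trans (cong (λ z → (a + z) % 2) (*-assoc 2 (2 ^ j) b)) ([m+2n]%2≡m%2 a (2 ^ j * b)))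
         (trans (cong (λ z → (a + z) / 2) (*-assoc 2 (2 ^ j) b)) ([m+2n]/2≡m/2+n a (2 ^ j * b))) ⟩
  (a % 2) * 2 ^ (j + n) + rev (j + n) (a / 2 + 2 ^ j * b)
    ≡⟨ cong₂ (λ u v → (a % 2) * u + v) (^-distribˡ-+-* 2 j n) (rev-concat j n (a / 2) b a/2<2^j) ⟩
  (a % 2) * (2 ^ j * 2 ^ n) + (rev j (a / 2) * 2 ^ n + rev n b)
    ≡⟨ reassociate (a % 2) (2 ^ j) (2 ^ n) (rev j (a / 2)) (rev n b) ⟩
  ((a % 2) * 2 ^ j + rev j (a / 2)) * 2 ^ n + rev n b
    ∎
  where
  open ≡-Reasoning
  a/2<2^j : a / 2 < 2 ^ j
  a/2<2^j = m<n*o⇒m/o<n (subst (a <_) (*-comm 2 (2 ^ j)) a<2^1+j)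
  reassociate : ∀ x y z u v → x * (y * z) + (u * z + v) ≡ (x * y + u) * z + v
  reassociate = solve-∀

rev-0 : ∀ k → rev k 0 ≡ 0
rev-0 zero    = refl
rev-0 (suc k) = rev-0 k

rev-involutive : ∀ k x → x < 2 ^ k → rev k (rev k x) ≡ x
rev-involutive zero    zero    _        = refl
rev-involutive zero    (suc x) (s≤s ())
rev-involutive (suc k) x x<2^1+k = begin
  rev (suc k) ((x % 2) * 2 ^ k + rev k (x / 2))
    ≡⟨ cong (rev (suc k)) (trans (+-comm ((x % 2) * 2 ^ k) _) (cong (rev k (x / 2) +_) (*-comm (x % 2) (2 ^ k)))) ⟩
  rev (suc k) (rev k (x / 2) + 2 ^ k * (x % 2))
    ≡⟨ subst (λ z → rev z (rev k (x / 2) + 2 ^ k * (x % 2)) ≡ rev k (rev k (x / 2)) * 2 + rev 1 (x % 2))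
         (+-comm k 1) (rev-concat k 1 (rev k (x / 2)) (x % 2) (rev<2^ k (x / 2))) ⟩
  rev k (rev k (x / 2)) * 2 + rev 1 (x % 2)
    ≡⟨ cong₂ _+_ (cong (_* 2) (rev-involutive k (x / 2) x/2<2^k)) rev1 ⟩
  (x / 2) * 2 + x % 2
    ≡⟨ +-comm ((x / 2) * 2) (x % 2) ⟩
  x % 2 + (x / 2) * 2
    ≡⟨ m≡m%n+[m/n]*n x 2 ⟨
  x ∎
  where
  open ≡-Reasoning
  x/2<2^k : x / 2 < 2 ^ k
  x/2<2^k = m<n*o⇒m/o<n (subst (x <_) (*-comm 2 (2 ^ k)) x<2^1+k)
  rev1 : rev 1 (x % 2) ≡ x % 2
  rev1 = trans (+-identityʳ _) (trans (*-identityʳ _) (m%n%n≡m%n x 2))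

rev-2^∸1 : ∀ L → rev L (2 ^ L ∸ 1) ≡ 2 ^ L ∸ 1
rev-2^∸1 zero    = refl
rev-2^∸1 (suc L) = begin
  rev (suc L) (2 * 2 ^ L ∸ 1)
    ≡⟨ cong (rev (suc L)) (2p∸1≡1+2[p∸1] (2 ^ L) (m^n>0 2 L)) ⟩
  rev (suc L) (1 + 2 * (2 ^ L ∸ 1))
    ≡⟨ cong₂ (λ u v → u * 2 ^ L + rev L v) ([m+2n]%2≡m%2 1 (2 ^ L ∸ 1)) ([m+2n]/2≡m/2+n 1 (2 ^ L ∸ 1)) ⟩
  1 * 2 ^ L + rev L (2 ^ L ∸ 1)
    ≡⟨ cong₂ _+_ (*-identityˡ (2 ^ L)) (rev-2^∸1 L) ⟩
  2 ^ L + (2 ^ L ∸ 1)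
    ≡⟨ p+[p∸1]≡2p∸1 (2 ^ L) (m^n>0 2 L) ⟩
  2 * 2 ^ L ∸ 1
    ∎
  where
  open ≡-Reasoning
  2p∸1≡1+2[p∸1] : ∀ p → 0 < p → 2 * p ∸ 1 ≡ 1 + 2 * (p ∸ 1)
  2p∸1≡1+2[p∸1] (suc q) _ = +-suc q (q + 0)
  p+[p∸1]≡2p∸1 : ∀ p → 0 < p → p + (p ∸ 1) ≡ 2 * p ∸ 1
  p+[p∸1]≡2p∸1 (suc q) _ = trans (cong (λ z → suc (q + z)) (sym (+-identityʳ q))) (sym (+-suc q (q + 0)))

2^∣⇒rev< : ∀ {f L m} → f ≤ L → 2 ^ f ∣ m → rev L m < 2 ^ (L ∸ f)
2^∣⇒rev< {f} {L} f≤L (divides q refl) = begin-strict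
  rev L (q * 2 ^ f)                   ≡⟨ cong₂ rev (sym (m+[n∸m]≡n f≤L)) (*-comm q (2 ^ f)) ⟩
  rev (f + (L ∸ f)) (0 + 2 ^ f * q)   ≡⟨ rev-concat f (L ∸ f) 0 q (m^n>0 2 f) ⟩
  rev f 0 * 2 ^ (L ∸ f) + rev (L ∸ f) q ≡⟨ cong (λ z → z * 2 ^ (L ∸ f) + rev (L ∸ f) q) (rev-0 f) ⟩
  rev (L ∸ f) q                       <⟨ rev<2^ (L ∸ f) q ⟩
  2 ^ (L ∸ f)                         ∎
  where open ≤-Reasoning

<2^⇒2^∣rev : ∀ {f L j} → f ≤ L → j < 2 ^ (L ∸ f) → 2 ^ f ∣ rev L j
<2^⇒2^∣rev {f} {L} {j} f≤L j<2^[L∸f] = divides (rev (L ∸ f) j) (begin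
  rev L j                                  ≡⟨ cong₂ rev (sym (m∸n+n≡m f≤L)) j≡j+2^[L∸f]*0 ⟩
  rev (L ∸ f + f) (j + 2 ^ (L ∸ f) * 0)    ≡⟨ rev-concat (L ∸ f) f j 0 j<2^[L∸f] ⟩
  rev (L ∸ f) j * 2 ^ f + rev f 0          ≡⟨ cong (rev (L ∸ f) j * 2 ^ f +_) (rev-0 f) ⟩
  rev (L ∸ f) j * 2 ^ f + 0                ≡⟨ +-identityʳ _ ⟩
  rev (L ∸ f) j * 2 ^ f                    ∎)
  where
  open ≡-Reasoning
  j≡j+2^[L∸f]*0 : j ≡ j + 2 ^ (L ∸ f) * 0
  j≡j+2^[L∸f]*0 = sym (trans (cong (j +_) (*-zeroʳ (2 ^ (L ∸ f)))) (+-identityʳ j))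

rev-earlier-deeper : ∀ L n {e m j} → e ≤ n + L → 2 ^ e ∣ m * 2 ^ n → j < rev L m → 2 ^ e ∣ rev L j * 2 ^ n
rev-earlier-deeper L n {e} {m} {j} e≤n+L 2^e∣m*2^n j<rev-m =
  2^∣*2^ {e} {n} (rev L j) (<2^⇒2^∣rev f≤L (<-trans j<rev-m (2^∣⇒rev< f≤L (2^∣*2^⁻¹ {e} {n} m 2^e∣m*2^n))))
  where
  f≤L : e ∸ n ≤ L
  f≤L = m≤n+o⇒m∸n≤o e n e≤n+L

-- The grid test of step 4

gridTest : ℕ → ℕ → ℕ → ℕ → Bool
gridTest n r₁ r₂ x₁ = ceilDiv (ℤ.+ r₁ ℤ.- ℤ.+ x₁) n ≤ℤᵇ floorDiv (ℤ.+ r₂ ℤ.- ℤ.+ x₁) n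

-[+m-+n]≡n⊖m : ∀ m n → ℤ.- (ℤ.+ m ℤ.- ℤ.+ n) ≡ n ℤ.⊖ m
-[+m-+n]≡n⊖m m n = trans (cong ℤ.-_ (trans (ℤ.[+m]-[+n]≡m⊖n m n) (ℤ.⊖-swap m n))) (ℤ.neg-involutive (n ℤ.⊖ m))

module _ (n : ℕ) where
  private
    D = 2 ^ n
    instance _ = m^n≢0 2 n

  ceilDiv-suc : ∀ B → Σ ℕ λ C → (ceilDiv (ℤ.+ suc B) n ≡ ℤ.+ C) × (suc B ≤ C * D) × (C * D < suc B + D)
  ceilDiv-suc B with suc B % D in rem≡
  ... | zero  = suc B / D , ℤ.neg-involutive (ℤ.+ (suc B / D)) , ≤-reflexive exact ,
                subst (_< suc B + D) exact (m<m+n (suc B) (m^n>0 2 n))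
    where
    exact : suc B ≡ (suc B / D) * D
    exact = trans (m≡m%n+[m/n]*n (suc B) D) (cong (_+ (suc B / D) * D) rem≡)
  ... | suc r = suc (suc B / D) , refl , lower , upper
    where
    split : suc B ≡ suc r + (suc B / D) * D
    split = trans (m≡m%n+[m/n]*n (suc B) D) (cong (_+ (suc B / D) * D) rem≡)
    lower : suc B ≤ D + (suc B / D) * D
    lower = subst (_≤ D + (suc B / D) * D) (sym split)
              (+-monoˡ-≤ ((suc B / D) * D) (<⇒≤ (subst (_< D) rem≡ (m%n<n (suc B) D))))
    upper : D + (suc B / D) * D < suc B + D
    upper = subst (D + (suc B / D) * D <_) (+-comm D (suc B))
              (+-monoʳ-< D (subst ((suc B / D) * D <_) (sym split) (m<n+m ((suc B / D) * D) z<s)))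

  data GridView (r₁ r₂ x₁ : ℕ) : Set where
    start-in-range : r₁ ≤ x₁ → T (gridTest n r₁ r₂ x₁) → GridView r₁ r₂ x₁
    start-below : ∀ B C → r₁ ≡ x₁ + suc B → suc B ≤ C * D → C * D < suc B + D →
                  gridTest n r₁ r₂ x₁ ≡ (C ≤ᵇ (r₂ ∸ x₁) / D) → GridView r₁ r₂ x₁

  gridView : ∀ r₁ r₂ x₁ → x₁ ≤ r₂ → GridView r₁ r₂ x₁
  gridView r₁ r₂ x₁ x₁≤r₂ with r₁ ≤? x₁
  ... | yes r₁≤x₁ =
    start-in-range r₁≤x₁ (subst T (sym test≡) (nonPos≤ᵇnonNeg ((x₁ ∸ r₁) / D) ((r₂ ∸ x₁) / D)))
    where
    test≡ : gridTest n r₁ r₂ x₁ ≡ (ℤ.- ℤ.+ ((x₁ ∸ r₁) / D) ℤ.≤ᵇ ℤ.+ ((r₂ ∸ x₁) / D))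
    test≡ = cong₂ _≤ℤᵇ_ (cong (λ z → ℤ.- floorDiv z n) (trans (-[+m-+n]≡n⊖m r₁ x₁) (ℤ.⊖-≥ r₁≤x₁)))
                        (cong (λ z → floorDiv z n) (trans (ℤ.[+m]-[+n]≡m⊖n r₂ x₁) (ℤ.⊖-≥ x₁≤r₂)))
    nonPos≤ᵇnonNeg : ∀ p q → T (ℤ.- ℤ.+ p ℤ.≤ᵇ ℤ.+ q)
    nonPos≤ᵇnonNeg zero    q = ≤⇒≤ᵇ {0} {q} z≤n
    nonPos≤ᵇnonNeg (suc p) q = _
  ... | no r₁≰x₁ with r₁ ∸ x₁ in gap≡
  ...   | zero  = contradiction (m∸n≡0⇒m≤n gap≡) r₁≰x₁
  ...   | suc B with ceilDiv-suc B
  ...     | C , ceil≡ , lower , upper = start-below B C r₁≡ lower upper (cong₂ _≤ℤᵇ_ ceil≡′ floor≡)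
    where
    x₁<r₁ = ≰⇒> r₁≰x₁
    r₁≡ : r₁ ≡ x₁ + suc B
    r₁≡ = trans (sym (m+[n∸m]≡n (<⇒≤ x₁<r₁))) (cong (x₁ +_) gap≡)
    ceil≡′ : ceilDiv (ℤ.+ r₁ ℤ.- ℤ.+ x₁) n ≡ ℤ.+ C
    ceil≡′ = trans (cong (λ z → ℤ.- floorDiv z n)
                     (trans (-[+m-+n]≡n⊖m r₁ x₁) (trans (ℤ.⊖-< x₁<r₁) (cong (λ z → ℤ.- (ℤ.+ z)) gap≡)))) ceil≡
    floor≡ : floorDiv (ℤ.+ r₂ ℤ.- ℤ.+ x₁) n ≡ ℤ.+ ((r₂ ∸ x₁) / D)
    floor≡ = cong (λ z → floorDiv z n) (trans (ℤ.[+m]-[+n]≡m⊖n r₂ x₁) (ℤ.⊖-≥ x₁≤r₂))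

  gridTest-sound : ∀ {r₁ r₂ x₁} → x₁ ≤ r₂ → T (gridTest n r₁ r₂ x₁) →
                   ∃ λ m → r₁ ≤ x₁ + m * D × x₁ + m * D ≤ r₂
  gridTest-sound {r₁} {r₂} {x₁} x₁≤r₂ test with gridView r₁ r₂ x₁ x₁≤r₂
  ... | start-in-range r₁≤x₁ _ =
    0 , subst (r₁ ≤_) (sym (+-identityʳ x₁)) r₁≤x₁ , subst (_≤ r₂) (sym (+-identityʳ x₁)) x₁≤r₂
  ... | start-below B C r₁≡ lower _ test≡ = C , subst (_≤ x₁ + C * D) (sym r₁≡) (+-monoʳ-≤ x₁ lower) , upper
    where
    C≤Q : C ≤ (r₂ ∸ x₁) / D
    C≤Q = ≤ᵇ⇒≤ C ((r₂ ∸ x₁) / D) (subst T test≡ test)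
    upper : x₁ + C * D ≤ r₂
    upper = subst (x₁ + C * D ≤_) (m+[n∸m]≡n x₁≤r₂)
              (+-monoʳ-≤ x₁ (≤-trans (*-monoˡ-≤ D C≤Q) (m/n*n≤m (r₂ ∸ x₁) D)))

  gridTest-complete : ∀ {r₁ r₂ x₁} m → r₁ ≤ x₁ + m * D → x₁ + m * D ≤ r₂ → T (gridTest n r₁ r₂ x₁)
  gridTest-complete {r₁} {r₂} {x₁} m lo hi with gridView r₁ r₂ x₁ (≤-trans (m≤m+n x₁ (m * D)) hi)
  ... | start-in-range _ test = test
  ... | start-below B C r₁≡ _ upper test≡ = subst T (sym test≡) (≤⇒≤ᵇ (≤-trans C≤m m≤Q))
    where
    C≤m : C ≤ m
    C≤m = <⇒≤pred (*-cancelʳ-< D C (suc m) (begin-strict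
      C * D       <⟨ upper ⟩
      suc B + D   ≤⟨ +-monoˡ-≤ D (+-cancelˡ-≤ x₁ (suc B) (m * D) (subst (_≤ x₁ + m * D) r₁≡ lo)) ⟩
      m * D + D   ≡⟨ +-comm (m * D) D ⟩
      suc m * D   ∎))
      where open ≤-Reasoning
    m≤Q : m ≤ (r₂ ∸ x₁) / D
    m≤Q = subst (_≤ (r₂ ∸ x₁) / D) (m*n/n≡m m D)
            (/-monoˡ-≤ D (subst (_≤ r₂ ∸ x₁) (m+n∸m≡n x₁ (m * D)) (∸-monoˡ-≤ x₁ hi)))

halveC-just : ∀ j → halveC (just j) ≡ initC j
halveC-just zero    = refl
halveC-just (suc j) = refl

module Machine (k r₁ r₂ : ℕ) where

  run-done : ∀ n y → run k r₁ r₂ n (done y) ≡ done y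
  run-done zero    y = refl
  run-done (suc n) y = run-done n y

  run-+ : ∀ a b s → run k r₁ r₂ (a + b) s ≡ run k r₁ r₂ b (run k r₁ r₂ a s)
  run-+ zero    b s = refl
  run-+ (suc a) b s = run-+ a b (step k r₁ r₂ s)

  run-mono : ∀ {a b s y} → a ≤ b → run k r₁ r₂ a s ≡ done y → run k r₁ r₂ b s ≡ done y
  run-mono {a} {b} {s} {y} a≤b halts = begin
    run k r₁ r₂ b s                             ≡⟨ cong (λ z → run k r₁ r₂ z s) (m+[n∸m]≡n a≤b) ⟨
    run k r₁ r₂ (a + (b ∸ a)) s                 ≡⟨ run-+ a (b ∸ a) s ⟩
    run k r₁ r₂ (b ∸ a) (run k r₁ r₂ a s)       ≡⟨ cong (run k r₁ r₂ (b ∸ a)) halts ⟩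
    run k r₁ r₂ (b ∸ a) (done y)                ≡⟨ run-done (b ∸ a) y ⟩
    done y                                      ∎
    where open ≡-Reasoning

  revChk-< : ∀ {x} → x < 2 ^ k → revChk k x ≡ just (rev k x)
  revChk-< x<2^k rewrite Reflects-true (<ᵇ-reflects-< _ _) x<2^k = refl

  step-fix-stop : ∀ {x} c → r₁ ≤ x → x ≤ r₂ → x < 2 ^ k → step k r₁ r₂ (fixLoop x c) ≡ done (rev k x)
  step-fix-stop {x} c r₁≤x x≤r₂ x<2^k
    rewrite Reflects-false (<ᵇ-reflects-< x r₁) (≤⇒≯ r₁≤x) | Reflects-false (<ᵇ-reflects-< r₂ x) (≤⇒≯ x≤r₂)
          | revChk-< x<2^k = refl

  step-fix-up : ∀ {x} j → x < r₁ → step k r₁ r₂ (fixLoop x (just j)) ≡ fixLoop (x + 2 ^ j) (initC j)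
  step-fix-up {x} j x<r₁ rewrite Reflects-true (<ᵇ-reflects-< x r₁) x<r₁ = cong (fixLoop (x + 2 ^ j)) (halveC-just j)

  step-fix-down : ∀ {x} j → r₁ ≤ x → r₂ < x → 2 ^ j ≤ x →
                  step k r₁ r₂ (fixLoop x (just j)) ≡ fixLoop (x ∸ 2 ^ j) (initC j)
  step-fix-down {x} j r₁≤x r₂<x 2^j≤x
    rewrite Reflects-false (<ᵇ-reflects-< x r₁) (≤⇒≯ r₁≤x) | Reflects-true (<ᵇ-reflects-< r₂ x) r₂<x
          | Reflects-true (≤ᵇ-reflects-≤ (2 ^ j) x) 2^j≤x = cong (fixLoop (x ∸ 2 ^ j)) (halveC-just j)

  growTest : ℕ → ℕ → Bool
  growTest l t′ = (l <ᵇ k) ∧ (modPow2 t′ (suc l) ≡ᵇ 0)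

  growTest-reflects : ∀ l t′ → Reflects (l < k × modPow2 t′ (suc l) ≡ 0) (growTest l t′)
  growTest-reflects l t′ = <ᵇ-reflects-< l k ×-reflects ≡ᵇ-reflects-≡ (modPow2 t′ (suc l)) 0

  blockTest : ℕ → ℕ → Bool
  blockTest l t′ = (r₁ ≤ᵇ rev k (t′ + 2 ^ l ∸ 1)) ∧ (rev k t′ ≤ᵇ r₂) ∧ gridTest (k ∸ l) r₁ r₂ (rev k t′)

  blockTest-reflects : ∀ l t′ →
    Reflects (r₁ ≤ rev k (t′ + 2 ^ l ∸ 1) × rev k t′ ≤ r₂ × T (gridTest (k ∸ l) r₁ r₂ (rev k t′))) (blockTest l t′)
  blockTest-reflects l t′ = ≤ᵇ-reflects-≤ _ _ ×-reflects (≤ᵇ-reflects-≤ _ _ ×-reflects T-reflects _)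

  step-grow : ∀ {l t′} → growTest l t′ ≡ true → step k r₁ r₂ (innerLoop l t′) ≡ innerLoop (suc l) t′
  step-grow grow rewrite grow = refl

  step-found : ∀ {l t′} → growTest l t′ ≡ false → t′ < 2 ^ k → t′ + 2 ^ l ∸ 1 < 2 ^ k →
               blockTest l t′ ≡ true →
               step k r₁ r₂ (innerLoop l t′) ≡ fixLoop (rev k t′) (initC k)
  step-found stop x₁-ok x₂-ok hit rewrite stop | revChk-< x₁-ok | revChk-< x₂-ok | hit = refl

  step-missed : ∀ {l t′} → growTest l t′ ≡ false → t′ < 2 ^ k → t′ + 2 ^ l ∸ 1 < 2 ^ k →
                blockTest l t′ ≡ false →
                step k r₁ r₂ (innerLoop l t′) ≡ repeatTop l (modPow2 (t′ + 2 ^ l) k)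
  step-missed stop x₁-ok x₂-ok miss rewrite stop | revChk-< x₁-ok | revChk-< x₂-ok | miss = refl

  record GrowExit (l t′ : ℕ) : Set where
    field
      grown    : ℕ
      fits     : grown + l ≤ k
      aligned  : 2 ^ (grown + l) ∣ t′
      stopped  : growTest (grown + l) t′ ≡ false
      reaches  : run k r₁ r₂ grown (innerLoop l t′) ≡ innerLoop (grown + l) t′

  grow : ∀ d l t′ → d + l ≡ k → 2 ^ l ∣ t′ → GrowExit l t′
  grow d l t′ d+l≡k 2^l∣t′ with growTest l t′ in test≡
  ... | false = record
    { grown = 0 ; fits = subst (l ≤_) d+l≡k (m≤n+m l d) ; aligned = 2^l∣t′ ; stopped = test≡ ; reaches = refl }
  ... | true with Reflects-invertʸ (growTest-reflects l t′) test≡ | d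
  ...   | l<k , _          | zero   = contradiction d+l≡k (<⇒≢ l<k)
  ...   | l<k , t′%2^1+l≡0 | suc d′ = record
    { grown   = suc grown
    ; fits    = subst (_≤ k) (+-suc grown l) fits
    ; aligned = subst (λ z → 2 ^ z ∣ t′) (+-suc grown l) aligned
    ; stopped = subst (λ z → growTest z t′ ≡ false) (+-suc grown l) stopped
    ; reaches = trans (cong (run k r₁ r₂ grown) (step-grow test≡))
                      (trans reaches (cong (λ z → innerLoop z t′) (+-suc grown l)))
    }
    where
    open GrowExit (grow d′ (suc l) t′ (trans (+-suc d′ l) d+l≡k)
                        (m%n≡0⇒n∣m t′ (2 ^ suc l) ⦃ m^n≢0 2 (suc l) ⦄ t′%2^1+l≡0))

-- The binary search of step 6

infix 4 _∈[_⋯_] _∉[_⋯_]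

_∈[_⋯_] : ℕ → ℕ → ℕ → Set
v ∈[ r₁ ⋯ r₂ ] = r₁ ≤ v × v ≤ r₂

_∉[_⋯_] : ℕ → ℕ → ℕ → Set
v ∉[ r₁ ⋯ r₂ ] = v < r₁ ⊎ r₂ < v

∈-or-∉ : ∀ v r₁ r₂ → v ∈[ r₁ ⋯ r₂ ] ⊎ v ∉[ r₁ ⋯ r₂ ]
∈-or-∉ v r₁ r₂ with r₁ ≤? v | v ≤? r₂
... | yes r₁≤v | yes v≤r₂ = inj₁ (r₁≤v , v≤r₂)
... | no  r₁≰v | _        = inj₂ (inj₁ (≰⇒> r₁≰v))
... | yes _    | no  v≰r₂ = inj₂ (inj₂ (≰⇒> v≰r₂))

∈⇒¬∉ : ∀ {v r₁ r₂} → v ∈[ r₁ ⋯ r₂ ] → ¬ v ∉[ r₁ ⋯ r₂ ]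
∈⇒¬∉ (r₁≤v , _) (inj₁ v<r₁) = <⇒≱ v<r₁ r₁≤v
∈⇒¬∉ (_ , v≤r₂) (inj₂ r₂<v) = <⇒≱ r₂<v v≤r₂

module BinarySearch (k r₁ r₂ x₁ : ℕ) (r₁≤r₂ : r₁ ≤ r₂) (r₂<2^k : r₂ < 2 ^ k) where
  open Machine k r₁ r₂

  Target : ℕ → Set
  Target w = x₁ + w ∈[ r₁ ⋯ r₂ ]

  Near : ℕ → ℕ → Set
  Near w e = ∀ w′ → Target w′ → w′ < w + 2 ^ e × w < w′ + 2 ^ e

  near-unique : ∀ {w w′} e → Near w e → 2 ^ e ∣ w → Target w′ → 2 ^ e ∣ w′ → w′ ≡ w
  near-unique e near 2^e∣w tw′ 2^e∣w′ =
    multiples-close⇒≡ 2^e∣w′ 2^e∣w (proj₁ (near _ tw′)) (proj₂ (near _ tw′))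

  near-up : ∀ {w j} → x₁ + w < r₁ → Near w (suc j) → Near (w + 2 ^ j) j
  near-up {w} {j} below near w′ tw′ =
    subst (w′ <_) (trans (cong (w +_) (cong (2 ^ j +_) (+-identityʳ (2 ^ j)))) (sym (+-assoc w (2 ^ j) (2 ^ j))))
          (proj₁ (near w′ tw′)) ,
    +-monoˡ-< (2 ^ j) w<w′
    where
    w<w′ : w < w′
    w<w′ = +-cancelˡ-< x₁ w w′ (<-≤-trans below (proj₁ tw′))

  near-down : ∀ {u j} → r₂ < x₁ + (u + 2 ^ j) → Near (u + 2 ^ j) (suc j) → Near u j
  near-down {u} {j} above near w′ tw′ =
    +-cancelˡ-< x₁ w′ (u + 2 ^ j) (≤-<-trans (proj₂ tw′) above) ,
    +-cancelʳ-< (2 ^ j) u (w′ + 2 ^ j)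
      (subst (u + 2 ^ j <_) (trans (cong (w′ +_) (cong (2 ^ j +_) (+-identityʳ (2 ^ j)))) (sym (+-assoc w′ (2 ^ j) (2 ^ j))))
             (proj₂ (near w′ tw′)))

  record Deepest : Set where
    field
      offset  : ℕ
      depth   : ℕ
      target  : Target offset
      depth≤k : depth ≤ k
      2^depth∣offset : 2 ^ depth ∣ offset
      unique  : ∀ w′ → Target w′ → 2 ^ depth ∣ w′ → w′ ≡ offset

  -- fixLoop x (initC e) is step 6 with c = 2^(e-1); e = 0 stands for c = 1/2.
  Searched : ℕ → ℕ → Set
  Searched e w = Σ Deepest λ d → run k r₁ r₂ (suc e) (fixLoop (x₁ + w) (initC e)) ≡ done (rev k (x₁ + Deepest.offset d))

  search : ∀ e w → e ≤ k → 2 ^ e ∣ w → ∃ Target → Near w e → Searched e w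
  search e w e≤k 2^e∣w (w₀ , tw₀) near with ∈-or-∉ (x₁ + w) r₁ r₂
  ... | inj₁ tw = record { offset = w ; depth = e ; target = tw ; depth≤k = e≤k ; 2^depth∣offset = 2^e∣w
                         ; unique = λ w′ tw′ 2^e∣w′ → near-unique e near 2^e∣w tw′ 2^e∣w′ } ,
                  trans (cong (run k r₁ r₂ e) (step-fix-stop (initC e) (proj₁ tw) (proj₂ tw) (≤-<-trans (proj₂ tw) r₂<2^k)))
                        (run-done e _)
  search zero w e≤k 2^e∣w (w₀ , tw₀) near | inj₂ out =
    contradiction out (∈⇒¬∉ (subst Target (near-unique 0 near 2^e∣w tw₀ (1∣ w₀)) tw₀))
  search (suc j) w e≤k 2^e∣w (w₀ , tw₀) near | inj₂ (inj₁ below) =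
    map₂ (trans (cong (run k r₁ r₂ (suc j)) moves))
         (search j (w + 2 ^ j) (≤-trans (n≤1+n j) e≤k) (∣m∣n⇒∣m+n 2^j∣w ∣-refl) (w₀ , tw₀)
                 (near-up {j = j} below near))
    where
    2^j∣w = ∣-trans (2^-mono-∣ (n≤1+n j)) 2^e∣w
    moves : step k r₁ r₂ (fixLoop (x₁ + w) (just j)) ≡ fixLoop (x₁ + (w + 2 ^ j)) (initC j)
    moves = trans (step-fix-up j below) (cong (λ z → fixLoop z (initC j)) (+-assoc x₁ w (2 ^ j)))
  search (suc j) w e≤k 2^e∣w (w₀ , tw₀) near | inj₂ (inj₂ above) =
    map₂ (trans (cong (run k r₁ r₂ (suc j)) moves))
         (search j u (≤-trans (n≤1+n j) e≤k) 2^j∣u (w₀ , tw₀)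
                 (near-down {j = j} (subst (λ z → r₂ < x₁ + z) w≡u+2^j above) (subst (λ z → Near z (suc j)) w≡u+2^j near)))
    where
    2^j∣w = ∣-trans (2^-mono-∣ (n≤1+n j)) 2^e∣w
    2^j≤w : 2 ^ j ≤ w
    2^j≤w = ∣⇒≤ ⦃ >-nonZero (≤-<-trans z≤n (+-cancelˡ-< x₁ w₀ w (≤-<-trans (proj₂ tw₀) above))) ⦄ 2^j∣w
    u = w ∸ 2 ^ j
    w≡u+2^j : w ≡ u + 2 ^ j
    w≡u+2^j = sym (m∸n+n≡m 2^j≤w)
    2^j∣u : 2 ^ j ∣ u
    2^j∣u = ∣m+n∣m⇒∣n (subst (2 ^ j ∣_) (trans w≡u+2^j (+-comm u (2 ^ j))) 2^j∣w) ∣-refl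
    moves : step k r₁ r₂ (fixLoop (x₁ + w) (just j)) ≡ fixLoop (x₁ + u) (initC j)
    moves = trans (step-fix-down j (≤-trans r₁≤r₂ (<⇒≤ above)) above (≤-trans 2^j≤w (m≤n+m w x₁)))
                  (cong (λ z → fixLoop z (initC j)) (begin
                    x₁ + w ∸ 2 ^ j          ≡⟨ cong (λ z → x₁ + z ∸ 2 ^ j) w≡u+2^j ⟩
                    x₁ + (u + 2 ^ j) ∸ 2 ^ j ≡⟨ cong (_∸ 2 ^ j) (+-assoc x₁ u (2 ^ j)) ⟨
                    x₁ + u + 2 ^ j ∸ 2 ^ j   ≡⟨ m+n∸n≡m (x₁ + u) (2 ^ j) ⟩
                    x₁ + u                  ∎))
      where open ≡-Reasoning

  module _ (dp : Deepest) where
    open Deepest dp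

    deepest-aligned : ∀ n {w₀} → Target w₀ → 2 ^ n ∣ w₀ → 2 ^ n ∣ offset
    deepest-aligned n tw₀ 2^n∣w₀ with depth ≤? n
    ... | yes depth≤n = subst (2 ^ n ∣_) (unique _ tw₀ (∣-trans (2^-mono-∣ depth≤n) 2^n∣w₀)) 2^n∣w₀
    ... | no  depth≰n = ∣-trans (2^-mono-∣ (<⇒≤ (≰⇒> depth≰n))) 2^depth∣offset

-- Aligned blocks

module Block (k L t′ : ℕ) (L≤k : L ≤ k) (2^L∣t′ : 2 ^ L ∣ t′) (t′<2^k : t′ < 2 ^ k) where

  n = k ∸ L
  D = 2 ^ n

  private
    b = quotient 2^L∣t′
    t′≡b*2^L : t′ ≡ b * 2 ^ L
    t′≡b*2^L = _∣_.equality 2^L∣t′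

    b<D : b < D
    b<D = *-cancelʳ-< (2 ^ L) b D (subst₂ _<_ t′≡b*2^L (2^-split L≤k) t′<2^k)

    rev-split : ∀ j → j < 2 ^ L → rev k (t′ + j) ≡ rev n b + rev L j * D
    rev-split j j<2^L = begin
      rev k (t′ + j)                  ≡⟨ cong (λ z → rev k (z + j)) t′≡b*2^L ⟩
      rev k (b * 2 ^ L + j)           ≡⟨ cong₂ rev (sym (m+[n∸m]≡n L≤k))
                                             (trans (+-comm (b * 2 ^ L) j) (cong (j +_) (*-comm b (2 ^ L)))) ⟩
      rev (L + n) (j + 2 ^ L * b)     ≡⟨ rev-concat L n j b j<2^L ⟩
      rev L j * D + rev n b           ≡⟨ +-comm (rev L j * D) (rev n b) ⟩
      rev n b + rev L j * D           ∎
      where open ≡-Reasoning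

    rev-start : rev k t′ ≡ rev n b
    rev-start = begin
      rev k t′                  ≡⟨ cong (rev k) (+-identityʳ t′) ⟨
      rev k (t′ + 0)            ≡⟨ rev-split 0 (m^n>0 2 L) ⟩
      rev n b + rev L 0 * D     ≡⟨ cong (λ z → rev n b + z * D) (rev-0 L) ⟩
      rev n b + 0               ≡⟨ +-identityʳ (rev n b) ⟩
      rev n b                   ∎
      where open ≡-Reasoning

  rev-start<D : rev k t′ < D
  rev-start<D = subst (_< D) (sym rev-start) (rev<2^ n b)

  rev-slot : ∀ j → j < 2 ^ L → rev k (t′ + j) ≡ rev k t′ + rev L j * D
  rev-slot j j<2^L = trans (rev-split j j<2^L) (cong (_+ rev L j * D) (sym rev-start))

  rev-grid : ∀ m → rev k (rev k t′ + m * D) ≡ t′ + rev L m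
  rev-grid m = begin
    rev k (rev k t′ + m * D)              ≡⟨ cong (λ z → rev k (z + m * D)) rev-start ⟩
    rev k (rev n b + m * D)               ≡⟨ cong₂ rev (m∸n+n≡m L≤k) (cong (rev n b +_) (*-comm D m)) ⟨
    rev (n + L) (rev n b + D * m)         ≡⟨ rev-concat n L (rev n b) m (rev<2^ n b) ⟩
    rev n (rev n b) * 2 ^ L + rev L m     ≡⟨ cong (λ z → z * 2 ^ L + rev L m) (rev-involutive n b b<D) ⟩
    b * 2 ^ L + rev L m                   ≡⟨ cong (_+ rev L m) t′≡b*2^L ⟨
    t′ + rev L m                          ∎
    where open ≡-Reasoning

  slot-fits : ∀ j → j < 2 ^ L → t′ + j < 2 ^ k
  slot-fits j j<2^L = <-≤-trans (+-monoʳ-< t′ j<2^L) (aligned-block-fits L≤k 2^L∣t′ t′<2^k)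

-- The scan over aligned blocks

module Scan (k t r₁ r₂ : ℕ) (r₁≤r₂ : r₁ ≤ r₂) (r₂<2^k : r₂ < 2 ^ k) where
  open Machine k r₁ r₂

  private instance
    2^k≢0 : NonZero (2 ^ k)
    2^k≢0 = m^n≢0 2 k

  slot : ℕ → ℕ
  slot d = modPow2 (t + d) k

  slot-+ : ∀ e j → slot (e + j) ≡ modPow2 (slot e + j) k
  slot-+ e j = begin
    (t + (e + j)) % 2 ^ k                          ≡⟨ cong (_% 2 ^ k) (+-assoc t e j) ⟨
    (t + e + j) % 2 ^ k                            ≡⟨ %-distribˡ-+ (t + e) j (2 ^ k) ⟩
    ((t + e) % 2 ^ k + j % 2 ^ k) % 2 ^ k          ≡⟨ cong (λ z → (z + j % 2 ^ k) % 2 ^ k) (m%n%n≡m%n (t + e) (2 ^ k)) ⟨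
    ((t + e) % 2 ^ k % 2 ^ k + j % 2 ^ k) % 2 ^ k  ≡⟨ %-distribˡ-+ ((t + e) % 2 ^ k) j (2 ^ k) ⟨
    ((t + e) % 2 ^ k + j) % 2 ^ k                  ∎
    where open ≡-Reasoning

  slot-+-< : ∀ {e t′ j} → slot e ≡ t′ → t′ + j < 2 ^ k → slot (e + j) ≡ t′ + j
  slot-+-< {e} {t′} {j} slot-e≡t′ t′+j<2^k =
    trans (slot-+ e j) (trans (cong (λ z → modPow2 (z + j) k) slot-e≡t′) (m<n⇒m%n≡m t′+j<2^k))

  MissedBefore : ℕ → Set
  MissedBefore e = ∀ d → 0 < d → d < e → rev k (slot d) ∉[ r₁ ⋯ r₂ ]

  record Answer (n : ℕ) (s : St) : Set where
    constructor answer
    field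
      value  : ℕ
      halts  : run k r₁ r₂ n s ≡ done value
      is-nsi : IsNsi k t r₁ r₂ value

  Answer-mono : ∀ {a b s} → a ≤ b → Answer a s → Answer b s
  Answer-mono a≤b (answer y halts nsi) = answer y (run-mono a≤b halts) nsi

  Answer-after : ∀ {a b s s′} → run k r₁ r₂ a s ≡ s′ → Answer b s′ → Answer (a + b) s
  Answer-after {a} {b} {s} reaches (answer y halts nsi) =
    answer y (trans (run-+ a b s) (trans (cong (run k r₁ r₂ b) reaches) halts)) nsi

  -- A missed block costs grown + 3 steps and raises L by grown + 1; the hit block costs at most k + 2.
  budget : ℕ → ℕ
  budget L = 3 * (k ∸ L) + (2 + k)

  budget-found : ∀ g L → g + L ≤ k → g + (2 + k) ≤ budget L
  budget-found g L g+L≤k =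
    +-monoˡ-≤ (2 + k) (≤-trans (m+n≤o⇒m≤o∸n g g+L≤k) (m≤m+n (k ∸ L) (k ∸ L + (k ∸ L + 0))))

  budget-missed : ∀ g L → suc (g + L) ≤ k → g + (3 + budget (suc (g + L))) ≤ budget L
  budget-missed g L 1+g+L≤k =
    ≤-trans (m≤m+n _ (g + g)) (≤-reflexive (trans (regroup g a (2 + k)) (sym budget-L≡)))
    where
    a = k ∸ suc (g + L)
    shuffle : ∀ g L a → suc (g + L) + a ≡ suc g + a + L
    shuffle = solve-∀
    k∸L≡ : k ∸ L ≡ suc g + a
    k∸L≡ = trans (cong (_∸ L) (trans (sym (m+[n∸m]≡n 1+g+L≤k)) (shuffle g L a))) (m+n∸n≡m (suc g + a) L)
    budget-L≡ : budget L ≡ 3 * (suc g + a) + (2 + k)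
    budget-L≡ = cong (λ z → 3 * z + (2 + k)) k∸L≡
    regroup : ∀ g a c → g + (3 + (3 * a + c)) + (g + g) ≡ 3 * (suc g + a) + c
    regroup = solve-∀

  MissedBefore-extend : ∀ {e n} → MissedBefore e → (∀ j → j < n → rev k (slot (e + j)) ∉[ r₁ ⋯ r₂ ]) →
                        MissedBefore (e + n)
  MissedBefore-extend {e} {n} missed missed-after d 0<d d<e+n with d <? e
  ... | yes d<e = missed d 0<d d<e
  ... | no  d≮e = subst (λ z → rev k (slot z) ∉[ r₁ ⋯ r₂ ]) d≡ (missed-after (d ∸ e) (+-cancelˡ-< e (d ∸ e) n
                    (subst (_< e + n) (sym d≡) d<e+n)))
    where
    d≡ : e + (d ∸ e) ≡ d
    d≡ = m+[n∸m]≡n (≮⇒≥ d≮e)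

  record Position (L t′ e : ℕ) : Set where
    field
      L≤k     : L ≤ k
      2^L∣t′  : 2 ^ L ∣ t′
      t′<2^k  : t′ < 2 ^ k
      0<e     : 0 < e
      at      : slot e ≡ t′
      missed  : MissedBefore e

  module AtBlock (L t′ e : ℕ) (pos : Position L t′ e) where
    open Position pos
    open Block k L t′ L≤k 2^L∣t′ t′<2^k

    x₁ = rev k t′

    open BinarySearch k r₁ r₂ x₁ r₁≤r₂ r₂<2^k

    rev-slot-in-block : ∀ j → j < 2 ^ L → rev k (slot (e + j)) ≡ x₁ + rev L j * D
    rev-slot-in-block j j<2^L = begin
      rev k (slot (e + j))        ≡⟨ cong (rev k) (slot-+-< at (slot-fits j j<2^L)) ⟩
      rev k (t′ + j)              ≡⟨ rev-slot j j<2^L ⟩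
      x₁ + rev L j * D            ∎
      where open ≡-Reasoning

    2^L∸1<2^L : 2 ^ L ∸ 1 < 2 ^ L
    2^L∸1<2^L = ∸-monoʳ-< {o = 0} z<s (m^n>0 2 L)

    last≡ : t′ + 2 ^ L ∸ 1 ≡ t′ + (2 ^ L ∸ 1)
    last≡ = +-∸-assoc t′ (m^n>0 2 L)

    last<2^k : t′ + 2 ^ L ∸ 1 < 2 ^ k
    last<2^k = subst (_< 2 ^ k) (sym last≡) (slot-fits (2 ^ L ∸ 1) 2^L∸1<2^L)

    rev-last : rev k (t′ + 2 ^ L ∸ 1) ≡ x₁ + (2 ^ L ∸ 1) * D
    rev-last = begin
      rev k (t′ + 2 ^ L ∸ 1)           ≡⟨ cong (rev k) last≡ ⟩
      rev k (t′ + (2 ^ L ∸ 1))         ≡⟨ rev-slot (2 ^ L ∸ 1) 2^L∸1<2^L ⟩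
      x₁ + rev L (2 ^ L ∸ 1) * D       ≡⟨ cong (λ z → x₁ + z * D) (rev-2^∸1 L) ⟩
      x₁ + (2 ^ L ∸ 1) * D             ∎
      where open ≡-Reasoning

    slots-missed : blockTest L t′ ≡ false → ∀ j → j < 2 ^ L → rev k (slot (e + j)) ∉[ r₁ ⋯ r₂ ]
    slots-missed miss j j<2^L with ∈-or-∉ (x₁ + rev L j * D) r₁ r₂
    ... | inj₂ out = subst (_∉[ r₁ ⋯ r₂ ]) (sym (rev-slot-in-block j j<2^L)) out
    ... | inj₁ (lo , hi) = contradiction (lo′ , ≤-trans (m≤m+n x₁ (rev L j * D)) hi , gridTest-complete n (rev L j) lo hi)
                                         (Reflects-invertⁿ (blockTest-reflects L t′) miss)
      where
      rev-j≤2^L∸1 : rev L j ≤ 2 ^ L ∸ 1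
      rev-j≤2^L∸1 = subst (rev L j ≤_) (pred[m∸n]≡m∸[1+n] (2 ^ L) 0) (<⇒≤pred (rev<2^ L j))
      lo′ : r₁ ≤ rev k (t′ + 2 ^ L ∸ 1)
      lo′ = subst (r₁ ≤_) (sym rev-last) (≤-trans lo (+-monoʳ-≤ x₁ (*-monoˡ-≤ D rev-j≤2^L∸1)))

    deepest-is-next : (dp : Deepest) → ∀ m → Deepest.offset dp ≡ m * D → IsNsi k t r₁ r₂ (rev k (x₁ + Deepest.offset dp))
    deepest-is-next dp m offset≡m*D =
      e + rev L m , <-≤-trans 0<e (m≤m+n e (rev L m)) , hit , MissedBefore-extend missed earlier , y≡
      where
      open Deepest dp
      y≡ : rev k (x₁ + offset) ≡ slot (e + rev L m)
      y≡ = begin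
        rev k (x₁ + offset)         ≡⟨ cong (λ z → rev k (x₁ + z)) offset≡m*D ⟩
        rev k (x₁ + m * D)          ≡⟨ rev-grid m ⟩
        t′ + rev L m                ≡⟨ slot-+-< at (slot-fits (rev L m) (rev<2^ L m)) ⟨
        slot (e + rev L m)          ∎
        where open ≡-Reasoning
      hit : rev k (slot (e + rev L m)) ∈[ r₁ ⋯ r₂ ]
      hit = subst (_∈[ r₁ ⋯ r₂ ]) rev-slot≡ target
        where
        rev-slot≡ : x₁ + offset ≡ rev k (slot (e + rev L m))
        rev-slot≡ = sym (trans (cong (rev k) (sym y≡)) (rev-involutive k (x₁ + offset) (≤-<-trans (proj₂ target) r₂<2^k)))
      earlier : ∀ j → j < rev L m → rev k (slot (e + j)) ∉[ r₁ ⋯ r₂ ]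
      earlier j j<rev-m with ∈-or-∉ (x₁ + rev L j * D) r₁ r₂
      ... | inj₂ out = subst (_∉[ r₁ ⋯ r₂ ]) (sym (rev-slot-in-block j j<2^L)) out
        where j<2^L = <-trans j<rev-m (rev<2^ L m)
      ... | inj₁ tj = contradiction j≡rev-m (<⇒≢ j<rev-m)
        where
        j<2^L = <-trans j<rev-m (rev<2^ L m)
        depth≤n+L : depth ≤ n + L
        depth≤n+L = subst (depth ≤_) (sym (m∸n+n≡m L≤k)) depth≤k
        rev-j≡m : rev L j ≡ m
        rev-j≡m = *-cancelʳ-≡ (rev L j) m D ⦃ m^n≢0 2 n ⦄
          (trans (unique _ tj (rev-earlier-deeper L n depth≤n+L (subst (2 ^ depth ∣_) offset≡m*D 2^depth∣offset) j<rev-m))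
                 offset≡m*D)
        j≡rev-m : j ≡ rev L m
        j≡rev-m = trans (sym (rev-involutive L j j<2^L)) (cong (rev L) rev-j≡m)

    on-hit : growTest L t′ ≡ false → blockTest L t′ ≡ true → Answer (suc (suc k)) (innerLoop L t′)
    on-hit stop hit = Answer-after {a = 1} enter found
      where
      x₁≤r₂ : x₁ ≤ r₂
      x₁≤r₂ = proj₁ (proj₂ (Reflects-invertʸ (blockTest-reflects L t′) hit))
      grid-hit = gridTest-sound n x₁≤r₂ (proj₂ (proj₂ (Reflects-invertʸ (blockTest-reflects L t′) hit)))
      enter : step k r₁ r₂ (innerLoop L t′) ≡ fixLoop (x₁ + 0) (initC k)
      enter = trans (step-found stop t′<2^k last<2^k hit) (cong (λ z → fixLoop z (initC k)) (sym (+-identityʳ x₁)))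
      near-start : Near 0 k
      near-start w′ (_ , x₁+w′≤r₂) =
        ≤-<-trans (m≤n+m w′ x₁) (≤-<-trans x₁+w′≤r₂ r₂<2^k) , <-≤-trans (m^n>0 2 k) (m≤n+m (2 ^ k) w′)
      found : Answer (suc k) (fixLoop (x₁ + 0) (initC k))
      found with search k 0 ≤-refl ((2 ^ k) ∣0) (proj₁ grid-hit * D , proj₂ grid-hit) near-start
      ... | dp , halts with deepest-aligned dp n (proj₂ grid-hit) (n∣m*n (proj₁ grid-hit))
      ...   | divides m offset≡m*D = answer (rev k (x₁ + Deepest.offset dp)) halts (deepest-is-next dp m offset≡m*D)

    t″ : ℕ
    t″ = modPow2 (t′ + 2 ^ L) k

    on-miss : growTest L t′ ≡ false → blockTest L t′ ≡ false →
             L < k × (run k r₁ r₂ 3 (innerLoop L t′) ≡ innerLoop (suc L) t″) × Position (suc L) t″ (e + 2 ^ L)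
    on-miss stop miss with L <? k
    ... | no L≮k = contradiction r₁-missed (∈⇒¬∉ (≤-refl , r₁≤r₂))
      where
      r₁<2^L : r₁ < 2 ^ L
      r₁<2^L = <-≤-trans (≤-<-trans r₁≤r₂ r₂<2^k) (^-monoʳ-≤ 2 (≮⇒≥ L≮k))
      single-slot : ∀ {x n′} → n′ ≡ 0 → x < 2 ^ n′ → x + r₁ * 2 ^ n′ ≡ r₁
      single-slot {zero}  refl _ = *-identityʳ r₁
      single-slot {suc _} refl (s≤s ())
      r₁≡ : rev k (slot (e + rev L r₁)) ≡ r₁
      r₁≡ = begin
        rev k (slot (e + rev L r₁))      ≡⟨ rev-slot-in-block (rev L r₁) (rev<2^ L r₁) ⟩
        x₁ + rev L (rev L r₁) * D        ≡⟨ cong (λ z → x₁ + z * D) (rev-involutive L r₁ r₁<2^L) ⟩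
        x₁ + r₁ * D                      ≡⟨ single-slot (m≤n⇒m∸n≡0 (≮⇒≥ L≮k)) rev-start<D ⟩
        r₁                               ∎
        where open ≡-Reasoning
      r₁-missed : r₁ ∉[ r₁ ⋯ r₂ ]
      r₁-missed = subst (_∉[ r₁ ⋯ r₂ ]) r₁≡ (slots-missed miss (rev L r₁) (rev<2^ L r₁))
    ... | yes L<k = L<k , reaches , record
      { L≤k = L<k ; 2^L∣t′ = 2^1+L∣t″ ; t′<2^k = m%n<n (t′ + 2 ^ L) (2 ^ k) ; 0<e = <-≤-trans 0<e (m≤m+n e (2 ^ L))
      ; at = trans (slot-+ e (2 ^ L)) (cong (λ z → modPow2 (z + 2 ^ L) k) at)
      ; missed = MissedBefore-extend missed (slots-missed miss) }
      where
      instance _ = m^n≢0 2 (suc L)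
      2^1+L∤t′ : ¬ (2 ^ suc L ∣ t′)
      2^1+L∤t′ 2^1+L∣t′ =
        Reflects-invertⁿ (growTest-reflects L t′) stop (L<k , n∣m⇒m%n≡0 t′ (2 ^ suc L) 2^1+L∣t′)
      2^1+L∣t″ : 2 ^ suc L ∣ t″
      2^1+L∣t″ = %-presˡ-∣ (2^∣+2^ L 2^L∣t′ 2^1+L∤t′) (2^-mono-∣ L<k)
      reaches : run k r₁ r₂ 3 (innerLoop L t′) ≡ innerLoop (suc L) t″
      reaches rewrite step-missed stop t′<2^k last<2^k miss =
        step-grow (Reflects-true (growTest-reflects L t″) (L<k , n∣m⇒m%n≡0 t″ (2 ^ suc L) 2^1+L∣t″))

  start-position : Position 0 (slot 1) 1
  start-position = record
    { L≤k = z≤n ; 2^L∣t′ = 1∣ slot 1 ; t′<2^k = m%n<n (t + 1) (2 ^ k) ; 0<e = z<s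
    ; at = refl ; missed = λ d 0<d d<1 → contradiction (≤-pred d<1) (<⇒≱ 0<d) }

  Position-grown : ∀ {L t′ e g} → Position L t′ e → g + L ≤ k → 2 ^ (g + L) ∣ t′ → Position (g + L) t′ e
  Position-grown pos g+L≤k 2^[g+L]∣t′ = record
    { L≤k = g+L≤k ; 2^L∣t′ = 2^[g+L]∣t′ ; t′<2^k = t′<2^k ; 0<e = 0<e ; at = at ; missed = missed }
    where open Position pos

  scan : ∀ fuel L t′ e → k ∸ L < fuel → Position L t′ e → Answer (budget L) (innerLoop L t′)
  scan (suc fuel) L t′ e k∸L<1+fuel pos = after-growth (grow (k ∸ L) L t′ (m∸n+n≡m L≤k) 2^L∣t′)
    where
    open Position pos
    after-growth : GrowExit L t′ → Answer (budget L) (innerLoop L t′)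
    after-growth record { grown = g ; fits = fits ; aligned = aligned ; stopped = stopped ; reaches = reaches }
      with blockTest (g + L) t′ in test≡
    ... | true  = Answer-mono (budget-found g L fits)
                    (Answer-after reaches (AtBlock.on-hit (g + L) t′ e (Position-grown pos fits aligned) stopped test≡))
    ... | false with AtBlock.on-miss (g + L) t′ e (Position-grown pos fits aligned) stopped test≡
    ...   | L′<k , steps , pos″ =
      Answer-mono (budget-missed g L L′<k)
        (Answer-after reaches (Answer-after {a = 3} steps (scan fuel (suc (g + L)) _ _ k∸L′<fuel pos″)))
      where
      k∸L′<fuel : k ∸ suc (g + L) < fuel
      k∸L′<fuel = <-≤-trans (∸-monoʳ-< (s≤s (m≤n+m L g)) L′<k) (≤-pred k∸L<1+fuel)

  algorithm-answers : Answer (4 * suc k) (initSt k t)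
  algorithm-answers = Answer-mono (steps≤ k) (Answer-after {a = 1} refl (scan (suc k) 0 (slot 1) 1 ≤-refl start-position))
    where
    steps≤ : ∀ k → 1 + (3 * k + (2 + k)) ≤ 4 * suc k
    steps≤ k = ≤-trans (n≤1+n _) (≤-reflexive (count k))
      where
      count : ∀ k → 1 + (1 + (3 * k + (2 + k))) ≡ 4 * suc k
      count = solve-∀

mainTheorem10 : Σ ℕ λ C → (k t r₁ r₂ : ℕ) → t < 2 ^ k → r₁ ≤ r₂ → r₂ < 2 ^ k →
    Σ ℕ λ y → (run k r₁ r₂ (C * suc k) (initSt k t) ≡ done y) × IsNsi k t r₁ r₂ y
-- t < 2^k is not needed: the slots are reduced modulo 2^k.
mainTheorem10 = 4 , λ k t r₁ r₂ _ r₁≤r₂ r₂<2^k →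
  let open Scan k t r₁ r₂ r₁≤r₂ r₂<2^k
      open Answer algorithm-answers
  in  value , halts , is-nsi
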